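{- Let $M$ be a connected matroid on $E$ such that there is no connected matroid $M'$ on $E$ with $\mathcal{B}(M')\subsetneq\mathcal{B}(M)$ (i.e. $M$ is minimal in the weak-map order among connected matroids of the same rank on $E$). Then the base polytope of $M$ is not decomposable.
   Context: $\mathcal{B}(N)$ is the family of bases of $N$. The base polytope is $B(N)=\mathrm{conv}\{\chi_B:B\in\mathcal{B}(N)\}$. $B(N)$ is decomposable if there exist at least two matroids $N_1,\dots,N_k$ on $E$ such that $B(N_1),\dots,B(N_k)$ form a polytopal subdivision of $B(N)$ (union is $B(N)$, any two intersect in a common proper face of both) and each $N_i$ has the same partition of $E$ into connected components as $N$.
   Formalization: The base polytopes are taken as sets of points with rational coordinates, and the linear functionals exposing their faces have rational coefficients. -}

module Defs where

open import Data.Nat using (ℕ; zero; suc; _≤_)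
open import Data.Fin using (Fin; zero; suc)
open import Data.Fin.Subset using (Subset; Side; inside; outside; _∈_; _∉_; _⊆_; _∪_; _-_; ⁅_⁆)
open import Data.Vec using (lookup)
open import Data.List using (List; []; _∷_; map)
open import Data.List.Relation.Unary.All using (All)
open import Data.Rational using (ℚ; 0ℚ; 1ℚ; _+_; _*_) renaming (_≤_ to _≤ℚ_)
open import Data.Product using (Σ; ∃; ∃-syntax; _×_; _,_; proj₁; proj₂)
open import Data.Empty using (⊥)
open import Relation.Nullary using (¬_)
open import Relation.Binary.PropositionalEquality using (_≡_)
open import Level using (0ℓ)

record Matroid (n : ℕ) : Set₁ where
  field
    Base     : Subset n → Set
    nonempty : ∃[ B ] Base B
    exchange : ∀ B₁ B₂ → Base B₁ → Base B₂ → ∀ x → x ∈ B₁ → x ∉ B₂ →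
               ∃[ y ] (y ∈ B₂ × y ∉ B₁ × Base ((B₁ - x) ∪ ⁅ y ⁆))

open Matroid public

module _ {n : ℕ} (M : Matroid n) where

  Independent : Subset n → Set
  Independent I = ∃[ B ] (Base M B × I ⊆ B)

  Circuit : Subset n → Set
  Circuit C = ¬ Independent C × (∀ D → D ⊆ C → ¬ Independent D → C ⊆ D)

  SameComponent : Fin n → Fin n → Set
  SameComponent e f = e ≡ f ⊎' ∃[ C ] (Circuit C × e ∈ C × f ∈ C)
    where
      open import Data.Sum using () renaming (_⊎_ to _⊎'_)

  Connected : Set
  Connected = ∀ e f → SameComponent e f

Point : ℕ → Set
Point n = Fin n → ℚ

sumFin : ∀ {n} → (Fin n → ℚ) → ℚ
sumFin {zero}  f = 0ℚ
sumFin {suc n} f = f zero + sumFin (λ i → f (suc i))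

dot : ∀ {n} → Point n → Point n → ℚ
dot w x = sumFin (λ i → w i * x i)

side01 : Side → ℚ
side01 inside  = 1ℚ
side01 outside = 0ℚ

χ : ∀ {n} → Subset n → Point n
χ B i = side01 (lookup B i)

sumList : List ℚ → ℚ
sumList []       = 0ℚ
sumList (q ∷ qs) = q + sumList qs

BasePolytope : ∀ {n} → Matroid n → Point n → Set
BasePolytope {n} M x =
  ∃[ L ] ( All (λ p → (0ℚ ≤ℚ proj₁ p) × Base M (proj₂ p)) L
         × sumList (map proj₁ L) ≡ 1ℚ
         × (∀ i → x i ≡ sumList (map (λ p → proj₁ p * χ (proj₂ p) i) L)) )

IsFace : ∀ {n} → (Point n → Set) → (Point n → Set) → Set
IsFace {n} Q P =
  (∀ x → ¬ Q x)
  ⊎' ∃[ w ] (∀ x → (Q x → P x × (∀ y → P y → dot w y ≤ℚ dot w x))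
                 × (P x × (∀ y → P y → dot w y ≤ℚ dot w x) → Q x))
  where open import Data.Sum using () renaming (_⊎_ to _⊎'_)

IsProperFace : ∀ {n} → (Point n → Set) → (Point n → Set) → Set
IsProperFace {n} Q P = IsFace Q P × ∃[ x ] (P x × ¬ Q x)

Intersection : ∀ {n} → (Point n → Set) → (Point n → Set) → Point n → Set
Intersection P Q x = P x × Q x

SameComponents : ∀ {n} → Matroid n → Matroid n → Set
SameComponents M N = ∀ e f → (SameComponent M e f → SameComponent N e f)
                           × (SameComponent N e f → SameComponent M e f)

-- B(N) is decomposable: there are k ≥ 2 matroids N₁,…,N_k on E whose base
-- polytopes form a polytopal subdivision of B(N), each with the same
-- connected components as N.
Decomposable : ∀ {n} → Matroid n → Set₁
Decomposable {n} N =
  Σ ℕ λ k → (2 ≤ k) × Σ (Fin k → Matroid n) λ Ns →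
      (∀ x → (BasePolytope N x → ∃[ i ] BasePolytope (Ns i) x)
           × (∃[ i ] BasePolytope (Ns i) x → BasePolytope N x))
    × (∀ i j → ¬ i ≡ j →
         IsProperFace (Intersection (BasePolytope (Ns i)) (BasePolytope (Ns j))) (BasePolytope (Ns i))
       × IsProperFace (Intersection (BasePolytope (Ns i)) (BasePolytope (Ns j))) (BasePolytope (Ns j)))
    × (∀ i → SameComponents (Ns i) N)

{-# OPTIONS --safe #-}

-- A 0/1-point χ B lies in the base polytope of N only if B is a base of N: in a convex
-- combination of 0/1-vectors equal to χ B, all the weight sits on B itself. So every tile
-- Nᵢ of a subdivision of B(M) has its bases among those of M. The tiles share the
-- components of M, hence are connected, and weak-map minimality makes their base families
-- equal to that of M. Two tiles then have the same polytope, so their intersection is not a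
-- proper face. Base is an arbitrary predicate, so the vertex argument only yields ¬¬ Base;
-- this suffices because the goal is a negation.

module Submission where

open import Defs
open import Data.Nat using (ℕ; zero; suc; s≤s)
open import Data.Fin using (Fin; zero; suc)
open import Data.Fin.Subset using (Subset; inside; outside)
open import Data.Bool using (Bool; true; false; not)
open import Data.Bool.Properties using (not-injective)
open import Data.Vec using (_∷_; []; lookup; tabulate)
open import Data.Vec.Properties using (tabulate∘lookup; tabulate-cong)
open import Data.List using (List; []; _∷_; map)
open import Data.List.Relation.Unary.All as All using (All; []; _∷_; mapM)
open import Data.Rational using (ℚ; 0ℚ; 1ℚ; _+_; _*_; _≤_)
open import Data.Rational.Properties
  using ( ≤-refl; ≤-trans; ≤-antisym; ≤-reflexive; +-mono-≤; +-monoʳ-≤; nonNegative⁻¹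
        ; +-comm; +-identityˡ; +-identityʳ; *-identityˡ; *-identityʳ; *-zeroʳ; _≟_
        ; +-0-group; +-0-commutativeMonoid)
open import Algebra.Bundles using (CommutativeMonoid)
open import Algebra.Properties.Group +-0-group using (identityˡ-unique)
open import Algebra.Properties.CommutativeSemigroup
  (CommutativeMonoid.commutativeSemigroup +-0-commutativeMonoid) using (interchange)
open import Data.Product using (∃-syntax; _×_; _,_; proj₁; proj₂)
open import Data.Sum using (_⊎_; inj₁; inj₂; map₂; fromInj₂)
open import Data.Empty using (⊥-elim)
open import Function using (const; _∘′_)
open import Level using (0ℓ)
open import Effect.Monad using (RawMonad)
open import Relation.Nullary using (¬_; yes; no; contradiction)
open import Relation.Nullary.Negation using (DoubleNegation; ¬¬-Monad; ¬¬-map)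
open import Relation.Binary.PropositionalEquality
  using (_≡_; _≢_; refl; sym; trans; cong; cong₂; subst; module ≡-Reasoning)

¬¬-→ : {A B : Set} → (A → DoubleNegation B) → DoubleNegation (A → B)
¬¬-→ f ¬[a→b] = ¬[a→b] (λ a → ⊥-elim (f a (λ b → ¬[a→b] (const b))))

¬¬-∀-Subset : ∀ {n} {P : Subset n → Set} →
  (∀ B → DoubleNegation (P B)) → DoubleNegation (∀ B → P B)
¬¬-∀-Subset {zero} f = ¬¬-map (λ p → λ { [] → p }) (f [])
¬¬-∀-Subset {suc n} f = do
  p-in  ← ¬¬-∀-Subset (λ B → f (inside ∷ B))
  p-out ← ¬¬-∀-Subset (λ B → f (outside ∷ B))
  pure λ { (inside ∷ B) → p-in B ; (outside ∷ B) → p-out B }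
  where open RawMonad ¬¬-Monad

nonNeg+nonNeg≡0⇒≡0 : ∀ {p q} → 0ℚ ≤ p → 0ℚ ≤ q → p + q ≡ 0ℚ → p ≡ 0ℚ
nonNeg+nonNeg≡0⇒≡0 {p} {q} 0≤p 0≤q p+q≡0 = ≤-antisym p≤0 0≤p
  where
  p≤0 : p ≤ 0ℚ
  p≤0 = ≤-trans (≤-reflexive (sym (+-identityʳ p)))
                (≤-trans (+-monoʳ-≤ p 0≤q) (≤-reflexive p+q≡0))

module _ {A : Set} (f : A → ℚ) where

  sumList-nonNeg : ∀ {xs} → All (λ a → 0ℚ ≤ f a) xs → 0ℚ ≤ sumList (map f xs)
  sumList-nonNeg []         = ≤-refl
  sumList-nonNeg (px ∷ pxs) = +-mono-≤ px (sumList-nonNeg pxs)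

  sumList-zeros : ∀ {xs} → All (λ a → f a ≡ 0ℚ) xs → sumList (map f xs) ≡ 0ℚ
  sumList-zeros []         = refl
  sumList-zeros (px ∷ pxs) = trans (cong₂ _+_ px (sumList-zeros pxs)) (+-identityʳ 0ℚ)

  sumList≡0⇒zeros : ∀ {xs} → All (λ a → 0ℚ ≤ f a) xs →
    sumList (map f xs) ≡ 0ℚ → All (λ a → f a ≡ 0ℚ) xs
  sumList≡0⇒zeros []         _ = []
  sumList≡0⇒zeros {x ∷ xs} (px ∷ pxs) sum≡0 = fx≡0 ∷ sumList≡0⇒zeros pxs rest≡0
    where
    fx≡0 : f x ≡ 0ℚ
    fx≡0 = nonNeg+nonNeg≡0⇒≡0 px (sumList-nonNeg pxs) sum≡0
    rest≡0 : sumList (map f xs) ≡ 0ℚ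
    rest≡0 = nonNeg+nonNeg≡0⇒≡0 (sumList-nonNeg pxs) px
               (trans (+-comm _ (f x)) sum≡0)

nonNeg*side01 : ∀ {w} b → 0ℚ ≤ w → 0ℚ ≤ w * side01 b
nonNeg*side01 {w} true  0≤w = ≤-trans 0≤w (≤-reflexive (sym (*-identityʳ w)))
nonNeg*side01 {w} false _   = ≤-reflexive (sym (*-zeroʳ w))

*side01≡0 : ∀ {w} b → w * side01 b ≡ 0ℚ → w ≡ 0ℚ ⊎ b ≡ false
*side01≡0 {w} true  w*1≡0 = inj₁ (trans (sym (*-identityʳ w)) w*1≡0)
*side01≡0     false _     = inj₂ refl

*side01-not+*side01 : ∀ w b → w * side01 (not b) + w * side01 b ≡ w
*side01-not+*side01 w true  = trans (cong₂ _+_ (*-zeroʳ w) (*-identityʳ w)) (+-identityˡ w)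
*side01-not+*side01 w false = trans (cong₂ _+_ (*-identityʳ w) (*-zeroʳ w)) (+-identityʳ w)

sumList-split : {A : Set} (w : A → ℚ) (s : A → Bool) (xs : List A) →
  sumList (map (λ a → w a * side01 (not (s a))) xs) + sumList (map (λ a → w a * side01 (s a)) xs)
  ≡ sumList (map w xs)
sumList-split w s []       = +-identityʳ 0ℚ
sumList-split w s (x ∷ xs) =
  trans (interchange (w x * side01 (not (s x))) _ (w x * side01 (s x)) _)
        (cong₂ _+_ (*side01-not+*side01 (w x) (s x)) (sumList-split w s xs))

Subset-ext : ∀ {n} {B B′ : Subset n} → (∀ i → lookup B′ i ≡ lookup B i) → B′ ≡ B
Subset-ext {B = B} {B′} agree = begin
  B′                    ≡⟨ sym (tabulate∘lookup B′) ⟩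
  tabulate (lookup B′)  ≡⟨ tabulate-cong agree ⟩
  tabulate (lookup B)   ≡⟨ tabulate∘lookup B ⟩
  B                     ∎
  where open ≡-Reasoning

module Support {n : ℕ} (B : Subset n) (L : List (ℚ × Subset n))
               (nonNeg : All (λ p → 0ℚ ≤ proj₁ p) L)
               (total : sumList (map proj₁ L) ≡ 1ℚ) where

  coordinate : Fin n → ℚ × Subset n → Bool
  coordinate i p = lookup (proj₂ p) i

  combination : Fin n → ℚ
  combination i = sumList (map (λ p → proj₁ p * side01 (coordinate i p)) L)

  -- χ B i is an average of the 0/1 values coordinate i p, so it can only equal
  -- their common value: the weight of every disagreeing summand vanishes.
  coordinate-agrees : ∀ i → χ B i ≡ combination i →
    All (λ p → proj₁ p ≡ 0ℚ ⊎ coordinate i p ≡ lookup B i) L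
  coordinate-agrees i χBi≡ with lookup B i
  ... | false = All.map (λ {p} → *side01≡0 (coordinate i p))
                  (sumList≡0⇒zeros _ (All.map (λ {p} → nonNeg*side01 (coordinate i p)) nonNeg)
                                     (sym χBi≡))
  ... | true  = All.map (λ {p} → map₂ not-injective ∘′ *side01≡0 (not (coordinate i p)))
                  (sumList≡0⇒zeros _ (All.map (λ {p} → nonNeg*side01 (not (coordinate i p))) nonNeg)
                                     (identityˡ-unique _ 1ℚ complement+1≡1))
    where
    complement : ℚ
    complement = sumList (map (λ p → proj₁ p * side01 (not (coordinate i p))) L)
    complement+1≡1 : complement + 1ℚ ≡ 1ℚ
    complement+1≡1 = begin
      complement + 1ℚ            ≡⟨ cong (complement +_) χBi≡ ⟩
      complement + combination i ≡⟨ sumList-split proj₁ (coordinate i) L ⟩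
      sumList (map proj₁ L)      ≡⟨ total ⟩
      1ℚ                         ∎
      where open ≡-Reasoning

  support : (∀ i → χ B i ≡ combination i) → All (λ p → proj₁ p ≡ 0ℚ ⊎ proj₂ p ≡ B) L
  support χB≡ = All.tabulate λ {p} p∈L →
    agrees p (λ i → All.lookup (coordinate-agrees i (χB≡ i)) p∈L)
    where
    agrees : ∀ p → (∀ i → proj₁ p ≡ 0ℚ ⊎ coordinate i p ≡ lookup B i) → proj₁ p ≡ 0ℚ ⊎ proj₂ p ≡ B
    agrees (w , B′) agree with w ≟ 0ℚ
    ... | yes w≡0 = inj₁ w≡0
    ... | no  w≢0 = inj₂ (Subset-ext λ i → fromInj₂ (λ w≡0 → contradiction w≡0 w≢0) (agree i))

module _ {n : ℕ} where

  χ∈BasePolytope : (M : Matroid n) {B : Subset n} → Base M B → BasePolytope M (χ B)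
  χ∈BasePolytope M {B} base =
    (1ℚ , B) ∷ [] , (nonNegative⁻¹ 1ℚ , base) ∷ [] , +-identityʳ 1ℚ ,
    λ i → sym (trans (+-identityʳ _) (*-identityˡ _))

  χ∈BasePolytope⇒¬¬Base : (M : Matroid n) {B : Subset n} →
    BasePolytope M (χ B) → DoubleNegation (Base M B)
  χ∈BasePolytope⇒¬¬Base M {B} (L , weighted , total , χB≡) ¬base =
    0≢1 (trans (sym (sumList-zeros proj₁ weights≡0)) total)
    where
    open Support B L (All.map proj₁ weighted) total
    weights≡0 : All (λ p → proj₁ p ≡ 0ℚ) L
    weights≡0 = All.zipWith
      (λ { (_ , inj₁ w≡0) → w≡0
         ; ((_ , base) , inj₂ B′≡B) → contradiction (subst (Base M) B′≡B base) ¬base })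
      (weighted , support χB≡)
    0≢1 : 0ℚ ≢ 1ℚ
    0≢1 ()

  BasePolytope-mono¬¬ : (M N : Matroid n) → (∀ B → Base M B → DoubleNegation (Base N B)) →
    ∀ {x} → BasePolytope M x → DoubleNegation (BasePolytope N x)
  BasePolytope-mono¬¬ M N M⊆N (L , weighted , total , comb) =
    ¬¬-map (λ weighted′ → L , weighted′ , total , comb)
      (mapM 0ℓ ¬¬-Monad (λ {p} (0≤w , base) → ¬¬-map (0≤w ,_) (M⊆N (proj₂ p) base)) weighted)

  BasePolytope⊆⇒¬¬Base⊆ : (M N : Matroid n) → (∀ x → BasePolytope N x → BasePolytope M x) →
    DoubleNegation (∀ B → Base N B → Base M B)
  BasePolytope⊆⇒¬¬Base⊆ M N N⊆M = ¬¬-∀-Subset λ B → ¬¬-→ λ base →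
    χ∈BasePolytope⇒¬¬Base M (N⊆M (χ B) (χ∈BasePolytope N base))

  Connected-transport : (M N : Matroid n) → SameComponents N M → Connected M → Connected N
  Connected-transport M N same conn e f = proj₂ (same e f) (conn e f)

corollary5p2 : (n : ℕ) (M : Matroid n) → Connected M →
    ¬ (∃[ M' ] (Connected M' × (∀ (B : Subset n) → Base M' B → Base M B)
                 × ∃[ B ] (Base M B × ¬ Base M' B))) →
    ¬ Decomposable M
corollary5p2 n M conn minimal (suc (suc k) , s≤s (s≤s _) , Ns , cover , faces , comps)
  with faces zero (suc zero) (λ ())
... | (_ , x , x∈N₀ , x∉N₀∩N₁) , _ =
  BasePolytope⊆⇒¬¬Base⊆ M N₀ (tile zero) λ N₀⊆M →
  BasePolytope⊆⇒¬¬Base⊆ M N₁ (tile (suc zero)) λ N₁⊆M →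
  BasePolytope-mono¬¬ N₀ N₁ (λ B base → M⊆N₁ N₁⊆M B (N₀⊆M B base)) x∈N₀ λ x∈N₁ →
  x∉N₀∩N₁ (x∈N₀ , x∈N₁)
  where
  N₀ N₁ : Matroid n
  N₀ = Ns zero
  N₁ = Ns (suc zero)
  tile : ∀ i x → BasePolytope (Ns i) x → BasePolytope M x
  tile i x x∈Nᵢ = proj₂ (cover x) (i , x∈Nᵢ)
  M⊆N₁ : (∀ B → Base N₁ B → Base M B) → ∀ B → Base M B → DoubleNegation (Base N₁ B)
  M⊆N₁ N₁⊆M B base ¬base =
    minimal (N₁ , Connected-transport M N₁ (comps (suc zero)) conn , N₁⊆M , B , base , ¬base)
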